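{- Let $G=(V,E)$ be a graph, $c$ a charge function, and $\Sigma$ a str-DNNF representing a subformula $F$ of $T(G,c)$. Let $(A,B)$ be a partition of $V$ and $a$ an assignment to $X_{E(A,B)}$ such that $F|a$ is satisfiable. Then there are str-DNNF $\Sigma_A$ and $\Sigma_B$, each of size at most $|\Sigma|$ and respecting the same vtree as $\Sigma$, that represent $F^a_A$ and $F^a_B$ respectively.
   Context: Graphs are undirected, without self-loops, possibly with parallel edges; $E(A,B)$ is the set of edges with one endpoint in $A$ and the other in $B$, and $X_{E'}=\{x_e : e\in E'\}$. Tseitin formulas: given $G=(V,E)$ and $c:V\to\{0,1\}$, associate a variable $x_e$ to each edge. For $v\in V$ with incident edge set $E(v)$, the constraint $\sum_{e\in E(v)}x_e\equiv c(v)\pmod 2$ is encoded by the CNF $F_{v,c}$ of the $2^{|E(v)|-1}$ clauses on all variables of $E(v)$ each excluding exactly one violating assignment; $T(G,c)=\bigwedge_v F_{v,c}$. A subformula of a CNF $F'$ is a CNF whose set of clauses is a subset of that of $F'$. For a partial assignment $a$, $F|a$ is obtained by deleting clauses with a literal made true by $a$ and deleting literals made false by $a$. For a subformula $F$ of $T(G,c)$, $F|a$ is a conjunction $F^a_A\land F^a_B$ where $F^a_A$ (resp. $F^a_B$) is the conjunction of the clauses of $F|a$ arising from clauses of the constraints $F_{v,c}$ with $v\in A$ (resp. $v\in B$); $F^a_A$ is a subformula of the Tseitin formula $T(G[A],c^a_A)$ and $F^a_B$ of $T(G[B],c^a_B)$ obtained by conditioning. A str-DNNF is a DNNF (circuit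 with literal/constant leaves, fan-in-2 $\lor$ and $\land$ nodes, each $\land$-node having inputs on disjoint variable sets; size = number of edges) equipped with a vtree (rooted binary tree with leaves in bijection with the variables) and a map $\lambda$ from circuit nodes to vtree nodes such that each $\land$-node's two inputs map into the subtrees of the two distinct children of its image, each $\lor$-node and its inputs have the same image, and the variables below each node $s$ are among those below $\lambda(s)$. A str-DNNF represents a formula if it computes an equivalent function. -}

module Defs where

open import Data.Bool using (Bool; true; false; _∧_; _∨_; not; _xor_; if_then_else_)
import Data.Bool as B
open import Data.Nat using (ℕ; zero; suc; _+_; _*_)
open import Data.Fin using (Fin; _≟_)
open import Data.List using (List; []; _∷_; _++_; filter; map; mapMaybe; foldr)
open import Data.Bool.ListAction using (all; any)
open import Data.Maybe using (Maybe; just; nothing)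
import Data.Vec
open import Data.Vec using (Vec; lookup) renaming ([] to []ᵥ; _∷_ to _∷ᵥ_)
open import Data.List.Base using () renaming (allFin to allFinL)
open import Data.Product using (Σ; _×_; _,_; proj₁; proj₂; ∃)
open import Data.Sum using (_⊎_)
open import Data.Unit using (⊤)
open import Relation.Nullary using (¬_)
open import Relation.Nullary.Decidable using (⌊_⌋)
open import Relation.Binary.PropositionalEquality using (_≡_; _≢_)

-- Graphs: n vertices, m edges (parallel edges allowed), no self-loops.

record Graph (n m : ℕ) : Set where
  field
    ends   : Fin m → Fin n × Fin n
    noLoop : (e : Fin m) → proj₁ (ends e) ≢ proj₂ (ends e)
open Graph public

incident : {n m : ℕ} → Graph n m → Fin n → Fin m → Bool
incident G v e = ⌊ proj₁ (ends G e) ≟ v ⌋ ∨ ⌊ proj₂ (ends G e) ≟ v ⌋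

edgesAt : {n m : ℕ} → Graph n m → Fin n → List (Fin m)
edgesAt G v = filter (λ e → B.T? (incident G v e)) (allFinL _)

-- CNF over the edge variables x_e (e : Fin m).
-- A literal (e , b) is true under x iff x e ≡ b.

Assignment : ℕ → Set
Assignment m = Fin m → Bool

Literal : ℕ → Set
Literal m = Fin m × Bool

Clause : ℕ → Set
Clause m = List (Literal m)

CNF : ℕ → Set
CNF m = List (Clause m)

evalLit : {m : ℕ} → Assignment m → Literal m → Bool
evalLit x (e , b) = ⌊ x e B.≟ b ⌋

evalClause : {m : ℕ} → Assignment m → Clause m → Bool
evalClause x C = any (evalLit x) C

evalCNF : {m : ℕ} → Assignment m → CNF m → Bool
evalCNF x F = all (evalClause x) F

Satisfiable : {m : ℕ} → CNF m → Set
Satisfiable F = ∃ λ x → evalCNF x F ≡ true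

parityAt : {n m : ℕ} → Graph n m → Fin n → Assignment m → Bool
parityAt G v β = foldr (λ e acc → β e xor acc) false (edgesAt G v)

Violating : {n m : ℕ} → Graph n m → (Fin n → Bool) → Fin n → Assignment m → Set
Violating G c v β = parityAt G v β ≡ not (c v)

clauseOf : {n m : ℕ} → Graph n m → Fin n → Assignment m → Clause m
clauseOf G v β = map (λ e → (e , not (β e))) (edgesAt G v)

-- A clause of T(G,c), tagged with the vertex v whose constraint F_{v,c}
-- it belongs to and the violating assignment β it excludes.
TaggedClause : ℕ → ℕ → Set
TaggedClause n m = Fin n × Assignment m

IsTseitinClause : {n m : ℕ} → Graph n m → (Fin n → Bool) → TaggedClause n m → Set
IsTseitinClause G c (v , β) = Violating G c v β

-- A subformula F of T(G,c) is given as a list of tagged clauses, each of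
-- which is a clause of F_{v,c} (checked by All (IsTseitinClause G c)).
toCNF : {n m : ℕ} → Graph n m → List (TaggedClause n m) → CNF m
toCNF G F = map (λ t → clauseOf G (proj₁ t) (proj₂ t)) F

-- Partition (A , B) of V given by inA (B = complement), and conditioning
-- on an assignment a to the cut variables X_{E(A,B)} (only the values of
-- a on cut edges are used).

crossing : {n m : ℕ} → Graph n m → (Fin n → Bool) → Fin m → Bool
crossing G inA e = inA (proj₁ (ends G e)) xor inA (proj₂ (ends G e))

-- C|a : nothing if C is satisfied by a (deleted), otherwise C with the
-- literals falsified by a removed.
condClause : {n m : ℕ} → Graph n m → (Fin n → Bool) → Assignment m → Clause m → Maybe (Clause m)
condClause G inA a C =
  if any (λ l → crossing G inA (proj₁ l) ∧ ⌊ a (proj₁ l) B.≟ proj₂ l ⌋) C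
  then nothing
  else just (filter (λ l → B.T? (not (crossing G inA (proj₁ l)))) C)

condCNF : {n m : ℕ} → Graph n m → (Fin n → Bool) → Assignment m → CNF m → CNF m
condCNF G inA a F = mapMaybe (condClause G inA a) F

restrict : {n m : ℕ} → Graph n m → (Fin n → Bool) → Assignment m → List (TaggedClause n m) → CNF m
restrict G inA a F = condCNF G inA a (toCNF G F)

restrictA : {n m : ℕ} → Graph n m → (Fin n → Bool) → Assignment m → List (TaggedClause n m) → CNF m
restrictA G inA a F = condCNF G inA a (toCNF G (filter (λ t → B.T? (inA (proj₁ t))) F))

restrictB : {n m : ℕ} → Graph n m → (Fin n → Bool) → Assignment m → List (TaggedClause n m) → CNF m
restrictB G inA a F = condCNF G inA a (toCNF G (filter (λ t → B.T? (not (inA (proj₁ t)))) F))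

data VTree (m : ℕ) : Set where
  leaf : Fin m → VTree m
  node : VTree m → VTree m → VTree m

countLeaf : {m : ℕ} → Fin m → VTree m → ℕ
countLeaf e (leaf f) = if ⌊ e ≟ f ⌋ then 1 else 0
countLeaf e (node l r) = countLeaf e l + countLeaf e r

IsVTree : {m : ℕ} → VTree m → Set
IsVTree {m} T = (e : Fin m) → countLeaf e T ≡ 1

data Dir : Set where
  L R : Dir

-- vtree nodes are addressed by paths from the root
Path : Set
Path = List Dir

subtreeAt : {m : ℕ} → VTree m → Path → Maybe (VTree m)
subtreeAt t [] = just t
subtreeAt (leaf _) (_ ∷ _) = nothing
subtreeAt (node l r) (L ∷ p) = subtreeAt l p
subtreeAt (node l r) (R ∷ p) = subtreeAt r p

ValidNode : {m : ℕ} → VTree m → Path → Set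
ValidNode T p = ∃ λ t → subtreeAt T p ≡ just t

VarBelow : {m : ℕ} → VTree m → Path → Fin m → Set
VarBelow T p e = ∃ λ t → subtreeAt T p ≡ just t × countLeaf e t ≡ 1

InSubtree : Path → Path → Set
InSubtree q p = ∃ λ r → q ≡ p ++ r

-- Circuits with fan-in-2 gates, presented as a list of gates in reverse
-- topological order: the head gate is the output; a gate sitting on top
-- of k earlier gates refers to them by Fin k (0 = most recent).
-- Each gate carries its image under λ (a vtree node).

data Gate (m k : ℕ) : Set where
  lit   : Fin m → Bool → Gate m k      -- literal x_e (true) or ¬x_e (false)
  const : Bool → Gate m k
  or    : Fin k → Fin k → Gate m k
  and   : Fin k → Fin k → Gate m k

data Circ (m : ℕ) : ℕ → Set where
  []  : Circ m 0
  _∷_ : {k : ℕ} → Gate m k × Path → Circ m k → Circ m (suc k)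

gateVal : {m k : ℕ} → Assignment m → Gate m k → Vec Bool k → Bool
gateVal x (lit e b) vs = ⌊ x e B.≟ b ⌋
gateVal x (const b) vs = b
gateVal x (or i j) vs = lookup vs i ∨ lookup vs j
gateVal x (and i j) vs = lookup vs i ∧ lookup vs j

values : {m k : ℕ} → Assignment m → Circ m k → Vec Bool k
values x [] = []ᵥ
values x ((g , _) ∷ C) = gateVal x g (values x C) ∷ᵥ values x C

gateVars : {m k : ℕ} → Gate m k → Vec (Fin m → Bool) k → (Fin m → Bool)
gateVars (lit e b) vs = λ f → ⌊ f ≟ e ⌋
gateVars (const b) vs = λ _ → false
gateVars (or i j) vs = λ f → lookup vs i f ∨ lookup vs j f
gateVars (and i j) vs = λ f → lookup vs i f ∨ lookup vs j f

varsAll : {m k : ℕ} → Circ m k → Vec (Fin m → Bool) k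
varsAll [] = []ᵥ
varsAll ((g , _) ∷ C) = gateVars g (varsAll C) ∷ᵥ varsAll C

labels : {m k : ℕ} → Circ m k → Vec Path k
labels [] = []ᵥ
labels ((_ , p) ∷ C) = p ∷ᵥ labels C

-- size = number of wires (edges) = 2 per ∧/∨ gate
gateSize : {m k : ℕ} → Gate m k → ℕ
gateSize (lit _ _) = 0
gateSize (const _) = 0
gateSize (or _ _) = 2
gateSize (and _ _) = 2

circSize : {m k : ℕ} → Circ m k → ℕ
circSize [] = 0
circSize ((g , _) ∷ C) = gateSize g + circSize C

GateOK : {m k : ℕ} → VTree m → Gate m k → Path → Circ m k → Set
GateOK T (lit e b) p C = ⊤
GateOK T (const b) p C = ⊤
GateOK T (or i j) p C = lookup (labels C) i ≡ p × lookup (labels C) j ≡ p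
GateOK {m} T (and i j) p C =
  -- decomposability: inputs on disjoint variable sets
  ((f : Fin m) → ¬ (lookup (varsAll C) i f ≡ true × lookup (varsAll C) j f ≡ true))
  -- structuredness: inputs map into the subtrees of the two distinct children
  × ((InSubtree (lookup (labels C) i) (p ++ (L ∷ [])) × InSubtree (lookup (labels C) j) (p ++ (R ∷ [])))
     ⊎ (InSubtree (lookup (labels C) i) (p ++ (R ∷ [])) × InSubtree (lookup (labels C) j) (p ++ (L ∷ []))))

StrWF : {m k : ℕ} → VTree m → Circ m k → Set
StrWF T [] = ⊤
StrWF {m} T ((g , p) ∷ C) =
  ValidNode T p
  × ((f : Fin m) → gateVars g (varsAll C) f ≡ true → VarBelow T p f)
  × GateOK T g p C
  × StrWF T C

record StrDNNF (m : ℕ) (T : VTree m) : Set where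
  field
    nGates : ℕ
    circ   : Circ m (suc nGates)
    wf     : StrWF T circ
open StrDNNF public

size : {m : ℕ} {T : VTree m} → StrDNNF m T → ℕ
size S = circSize (circ S)

output : {m : ℕ} {T : VTree m} → StrDNNF m T → Assignment m → Bool
output S x = Data.Vec.head (values x (circ S))

Represents : {m : ℕ} {T : VTree m} → StrDNNF m T → CNF m → Set
Represents {m} S F = (x : Assignment m) → output S x ≡ evalCNF x F

{-# OPTIONS --safe #-}
-- Fix an assignment s satisfying F|a. Replacing every literal of Σ on a variable outside
-- G[A] by the constant it takes under "a on the cut, s elsewhere" changes only leaves, so
-- the result is a str-DNNF over the same vtree and of the same size. It computes F at the
-- assignment that agrees with x on G[A], with a on the cut and with s on G[B]. There a
-- clause of a vertex of A takes the value its conditioning takes at x, and a clause of a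
-- vertex of B the value its conditioning takes at s, which is true; so the circuit
-- represents F^a_A. The same construction with the sides exchanged gives F^a_B.
module Submission where

open import Defs
open import Data.Nat using (ℕ; _≤_)
open import Data.Bool using (Bool)
open import Data.Fin using (Fin)
open import Data.List using (List)
open import Data.List.Relation.Unary.All using (All)
open import Data.Product using (Σ-syntax; _×_)

open import Algebra.Bundles using (CommutativeMonoid)
import Algebra.Properties.CommutativeSemigroup as CommutativeSemigroupProperties
open import Data.Bool using (true; false; _∧_; _∨_; not; _xor_; if_then_else_; T)
import Data.Bool as B
open import Data.Bool.ListAction using (all; any)
import Data.Bool.ListAction as ListAction
open import Data.Bool.Properties using (∨-assoc; ∨-zeroʳ; ∨-commutativeMonoid; if-cong; if-float)
open import Data.Empty using (⊥-elim)
open import Data.Nat using (_+_)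
open import Data.Fin using (zero; suc; _≟_)
open import Data.List using ([]; _∷_; filter; mapMaybe)
import Data.List.Base as List
open import Data.List.Properties using (map-∘; mapMaybe-map)
import Data.List.Relation.Unary.All as All
open import Data.List.Relation.Unary.All.Properties using (all-filter; map⁺)
open import Data.Maybe using (Maybe; just; nothing; maybe′)
open import Data.Nat.Properties using (≤-reflexive)
open import Data.Product using (_,_; proj₁; proj₂)
open import Data.Unit using (tt)
open import Data.Vec using (Vec; lookup; head) renaming (_∷_ to _∷ᵥ_)
open import Function using (_∘_)
open import Relation.Nullary using (yes; no)
open import Relation.Nullary.Decidable using (⌊_⌋)
open import Relation.Binary.PropositionalEquality
  using (_≡_; refl; sym; trans; cong; cong₂; module ≡-Reasoning)

∨-swap : ∀ x y z → x ∨ (y ∨ z) ≡ y ∨ (x ∨ z)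
∨-swap = CommutativeSemigroupProperties.x∙yz≈y∙xz
  (CommutativeMonoid.commutativeSemigroup ∨-commutativeMonoid)

∨-mono-true : ∀ {x y x′ y′} → (x′ ≡ true → x ≡ true) → (y′ ≡ true → y ≡ true) →
              x′ ∨ y′ ≡ true → x ∨ y ≡ true
∨-mono-true {x′ = true} x′⇒x y′⇒y h rewrite x′⇒x refl = refl
∨-mono-true {x} {x′ = false} {true} x′⇒x y′⇒y h rewrite y′⇒y refl = ∨-zeroʳ x

∧≡true⇒× : ∀ {x y} → x ∧ y ≡ true → x ≡ true × y ≡ true
∧≡true⇒× {true} {true} refl = refl , refl

xor≡false⇒≡ : ∀ {x y} → x xor y ≡ false → x ≡ y
xor≡false⇒≡ {false} {false} refl = refl
xor≡false⇒≡ {true} {true} refl = refl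

all-filter-if : {A : Set} (p f g h : A → Bool) →
                (∀ t → g t ≡ (if p t then f t else h t)) →
                ∀ ts → all h ts ≡ true → all f (filter (B.T? ∘ p) ts) ≡ all g ts
all-filter-if p f g h split [] _ = refl
all-filter-if p f g h split (t ∷ ts) hs with p t in pt | ∧≡true⇒× {h t} hs
... | true  | _ , hs′ = cong₂ _∧_ (sym (trans (split t) (if-cong pt)))
                                  (all-filter-if p f g h split ts hs′)
... | false | ht , hs′ = trans (all-filter-if p f g h split ts hs′)
                               (cong (_∧ all g ts) (sym (trans (split t) (trans (if-cong pt) ht))))

evalCond : {m : ℕ} → Assignment m → Maybe (Clause m) → Bool
evalCond x = maybe′ (evalClause x) true

evalClause-cong : {m : ℕ} {x y : Assignment m} (C : Clause m) →
                  All (λ l → x (proj₁ l) ≡ y (proj₁ l)) C → evalClause x C ≡ evalClause y C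
evalClause-cong [] All.[] = refl
evalClause-cong ((e , b) ∷ C) (xe≡ye All.∷ agree) =
  cong₂ _∨_ (cong (λ u → ⌊ u B.≟ b ⌋) xe≡ye) (evalClause-cong C agree)

evalCNF-mapMaybe : {A : Set} {m : ℕ} (x : Assignment m) (f : A → Maybe (Clause m)) (ts : List A) →
                   evalCNF x (mapMaybe f ts) ≡ all (evalCond x ∘ f) ts
evalCNF-mapMaybe x f [] = refl
evalCNF-mapMaybe x f (t ∷ ts) with f t
... | nothing = evalCNF-mapMaybe x f ts
... | just C  = cong (evalClause x C ∧_) (evalCNF-mapMaybe x f ts)

clauseOfTagged : {n m : ℕ} → Graph n m → TaggedClause n m → Clause m
clauseOfTagged G t = clauseOf G (proj₁ t) (proj₂ t)

evalCNF-toCNF : {n m : ℕ} (G : Graph n m) (x : Assignment m) (F : List (TaggedClause n m)) →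
                evalCNF x (toCNF G F) ≡ all (evalClause x ∘ clauseOfTagged G) F
evalCNF-toCNF G x F = cong ListAction.and (sym (map-∘ F))

override : {m : ℕ} → (Fin m → Bool) → Assignment m → Assignment m → Assignment m
override keep x z e = if keep e then x e else z e

_⊆ᵇ_ : {m : ℕ} → (Fin m → Bool) → (Fin m → Bool) → Set
p ⊆ᵇ q = ∀ f → p f ≡ true → q f ≡ true

module Conditioning {m : ℕ} (keep : Fin m → Bool) (z : Assignment m) where

  conditionGate : {k : ℕ} → Gate m k → Gate m k
  conditionGate (lit e b) = if keep e then lit e b else const ⌊ z e B.≟ b ⌋
  conditionGate (const b) = const b
  conditionGate (or i j)  = or i j
  conditionGate (and i j) = and i j

  conditionCirc : {k : ℕ} → Circ m k → Circ m k
  conditionCirc [] = []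
  conditionCirc ((g , p) ∷ C) = (conditionGate g , p) ∷ conditionCirc C

  gateVal-conditionGate : {k : ℕ} (x : Assignment m) (g : Gate m k) (vs : Vec Bool k) →
                          gateVal x (conditionGate g) vs ≡ gateVal (override keep x z) g vs
  gateVal-conditionGate x (lit e b) vs with keep e
  ... | true  = refl
  ... | false = refl
  gateVal-conditionGate x (const b) vs = refl
  gateVal-conditionGate x (or i j)  vs = refl
  gateVal-conditionGate x (and i j) vs = refl

  values-conditionCirc : {k : ℕ} (x : Assignment m) (C : Circ m k) →
                         values x (conditionCirc C) ≡ values (override keep x z) C
  values-conditionCirc x [] = refl
  values-conditionCirc x ((g , p) ∷ C) rewrite values-conditionCirc x C =
    cong (_∷ᵥ values (override keep x z) C) (gateVal-conditionGate x g _)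

  labels-conditionCirc : {k : ℕ} (C : Circ m k) → labels (conditionCirc C) ≡ labels C
  labels-conditionCirc [] = refl
  labels-conditionCirc ((g , p) ∷ C) = cong (p ∷ᵥ_) (labels-conditionCirc C)

  gateSize-conditionGate : {k : ℕ} (g : Gate m k) → gateSize (conditionGate g) ≡ gateSize g
  gateSize-conditionGate (lit e b) with keep e
  ... | true  = refl
  ... | false = refl
  gateSize-conditionGate (const b) = refl
  gateSize-conditionGate (or i j)  = refl
  gateSize-conditionGate (and i j) = refl

  circSize-conditionCirc : {k : ℕ} (C : Circ m k) → circSize (conditionCirc C) ≡ circSize C
  circSize-conditionCirc [] = refl
  circSize-conditionCirc ((g , p) ∷ C) =
    cong₂ _+_ (gateSize-conditionGate g) (circSize-conditionCirc C)

  gateVars-conditionGate-⊆ : {k : ℕ} (g : Gate m k) {V′ V : Vec (Fin m → Bool) k} →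
                             (∀ i → lookup V′ i ⊆ᵇ lookup V i) →
                             gateVars (conditionGate g) V′ ⊆ᵇ gateVars g V
  gateVars-conditionGate-⊆ (lit e b) V′⊆V f h with keep e
  ... | true = h
  gateVars-conditionGate-⊆ (or i j)  V′⊆V f = ∨-mono-true (V′⊆V i f) (V′⊆V j f)
  gateVars-conditionGate-⊆ (and i j) V′⊆V f = ∨-mono-true (V′⊆V i f) (V′⊆V j f)

  varsAll-conditionCirc-⊆ : {k : ℕ} (C : Circ m k) (i : Fin k) →
                            lookup (varsAll (conditionCirc C)) i ⊆ᵇ lookup (varsAll C) i
  varsAll-conditionCirc-⊆ ((g , p) ∷ C) zero =
    gateVars-conditionGate-⊆ g (varsAll-conditionCirc-⊆ C)
  varsAll-conditionCirc-⊆ ((g , p) ∷ C) (suc i) = varsAll-conditionCirc-⊆ C i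

  GateOK-conditionGate : {k : ℕ} (T : VTree m) (g : Gate m k) (p : Path) (C : Circ m k) →
                         GateOK T g p C → GateOK T (conditionGate g) p (conditionCirc C)
  GateOK-conditionGate T (lit e b) p C ok with keep e
  ... | true  = tt
  ... | false = tt
  GateOK-conditionGate T (const b) p C ok = tt
  GateOK-conditionGate T (or i j) p C ok rewrite labels-conditionCirc C = ok
  GateOK-conditionGate T (and i j) p C (disjoint , structured) rewrite labels-conditionCirc C =
    (λ f (hi , hj) → disjoint f (varsAll-conditionCirc-⊆ C i f hi , varsAll-conditionCirc-⊆ C j f hj))
    , structured

  StrWF-conditionCirc : {k : ℕ} (T : VTree m) (C : Circ m k) → StrWF T C → StrWF T (conditionCirc C)
  StrWF-conditionCirc T [] _ = tt
  StrWF-conditionCirc T ((g , p) ∷ C) (valid , below , ok , wf) =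
    valid
    , (λ f h → below f (gateVars-conditionGate-⊆ g (varsAll-conditionCirc-⊆ C) f h))
    , GateOK-conditionGate T g p C ok
    , StrWF-conditionCirc T C wf

  condition : {T : VTree m} → StrDNNF m T → StrDNNF m T
  condition {T} S = record
    { nGates = nGates S
    ; circ   = conditionCirc (circ S)
    ; wf     = StrWF-conditionCirc T (circ S) (wf S)
    }

  size-condition : {T : VTree m} (S : StrDNNF m T) → size (condition S) ≡ size S
  size-condition S = circSize-conditionCirc (circ S)

  output-condition : {T : VTree m} (S : StrDNNF m T) (x : Assignment m) →
                     output (condition S) x ≡ output S (override keep x z)
  output-condition S x = cong head (values-conditionCirc x (circ S))

module Cut {n m : ℕ} (G : Graph n m) (inA : Fin n → Bool) (a : Assignment m) where

  cond : Clause m → Maybe (Clause m)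
  cond = condClause G inA a

  fixCut : Assignment m → Assignment m
  fixCut z e = if crossing G inA e then a e else z e

  cutSatisfied : Literal m → Bool
  cutSatisfied l = crossing G inA (proj₁ l) ∧ ⌊ a (proj₁ l) B.≟ proj₂ l ⌋

  offCut : Clause m → Clause m
  offCut = filter (λ l → B.T? (not (crossing G inA (proj₁ l))))

  evalClause-fixCut : (z : Assignment m) (C : Clause m) →
                      evalClause (fixCut z) C ≡ any cutSatisfied C ∨ evalClause z (offCut C)
  evalClause-fixCut z [] = refl
  evalClause-fixCut z ((e , b) ∷ C) with crossing G inA e
  ... | true  = trans (cong (⌊ a e B.≟ b ⌋ ∨_) (evalClause-fixCut z C))
                      (sym (∨-assoc ⌊ a e B.≟ b ⌋ (any cutSatisfied C) (evalClause z (offCut C))))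
  ... | false = trans (cong (⌊ z e B.≟ b ⌋ ∨_) (evalClause-fixCut z C))
                      (∨-swap ⌊ z e B.≟ b ⌋ (any cutSatisfied C) (evalClause z (offCut C)))

  evalCond-cond : (z : Assignment m) (C : Clause m) →
                  evalCond z (cond C) ≡ any cutSatisfied C ∨ evalClause z (offCut C)
  evalCond-cond z C with any cutSatisfied C
  ... | true  = refl
  ... | false = refl

  evalClause-fixCut-cond : (z : Assignment m) (C : Clause m) →
                           evalClause (fixCut z) C ≡ evalCond z (cond C)
  evalClause-fixCut-cond z C = trans (evalClause-fixCut z C) (sym (evalCond-cond z C))

  evalCNF-restrict : (x : Assignment m) (F : List (TaggedClause n m)) →
                     evalCNF x (restrict G inA a F) ≡ all (evalCond x ∘ cond ∘ clauseOfTagged G) F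
  evalCNF-restrict x F = trans (cong (evalCNF x) (mapMaybe-map cond (clauseOfTagged G) F))
                               (evalCNF-mapMaybe x (cond ∘ clauseOfTagged G) F)

  RespectsCut : (Fin n → Bool) → Set
  RespectsCut P = ∀ e → crossing G inA e ≡ false → P (proj₁ (ends G e)) ≡ P (proj₂ (ends G e))

  inA-respectsCut : RespectsCut inA
  inA-respectsCut e = xor≡false⇒≡

  not-respectsCut : {P : Fin n → Bool} → RespectsCut P → RespectsCut (not ∘ P)
  not-respectsCut resp e uncut = cong not (resp e uncut)

  respectsCut-incident : {P : Fin n → Bool} → RespectsCut P → {v : Fin n} {e : Fin m} →
                         T (incident G v e) → crossing G inA e ≡ false → P (proj₁ (ends G e)) ≡ P v
  respectsCut-incident resp {v} {e} inc uncut with proj₁ (ends G e) ≟ v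
  ... | yes refl = refl
  ... | no _ with proj₂ (ends G e) ≟ v
  ...   | yes refl = resp e uncut
  ...   | no _ = ⊥-elim inc

  inside : (Fin n → Bool) → Fin m → Bool
  inside P e = not (crossing G inA e) ∧ P (proj₁ (ends G e))

  override-inside-incident : {P : Fin n → Bool} → RespectsCut P →
                             (x s : Assignment m) {v : Fin n} {e : Fin m} → T (incident G v e) →
                             override (inside P) x (fixCut s) e ≡ fixCut (if P v then x else s) e
  override-inside-incident {P} resp x s {v} {e} inc with crossing G inA e in ce
  ... | true = refl
  ... | false = trans (if-cong (respectsCut-incident {P} resp inc ce))
                      (sym (if-float (λ z → z e) (P v) {x} {s}))

  evalClause-override-inside : {P : Fin n → Bool} → RespectsCut P → (x s : Assignment m)
                               (v : Fin n) (β : Assignment m) →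
                               evalClause (override (inside P) x (fixCut s)) (clauseOf G v β)
                               ≡ evalCond (if P v then x else s) (cond (clauseOf G v β))
  evalClause-override-inside {P} resp x s v β =
    trans (evalClause-cong (clauseOf G v β)
            (map⁺ (All.map (override-inside-incident {P} resp x s)
                           (all-filter (λ e → B.T? (incident G v e)) (List.allFin m)))))
          (evalClause-fixCut-cond (if P v then x else s) (clauseOf G v β))

  conditionSide : {T : VTree m} → (Fin n → Bool) → Assignment m → StrDNNF m T → StrDNNF m T
  conditionSide P s = Conditioning.condition (inside P) (fixCut s)

  size-conditionSide : {T : VTree m} (P : Fin n → Bool) (s : Assignment m) (S : StrDNNF m T) →
                       size (conditionSide P s S) ≡ size S
  size-conditionSide P s = Conditioning.size-condition (inside P) (fixCut s)

  conditionSide-represents : {T : VTree m} (S : StrDNNF m T) (F : List (TaggedClause n m)) →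
                             Represents S (toCNF G F) →
                             (s : Assignment m) → evalCNF s (restrict G inA a F) ≡ true →
                             (P : Fin n → Bool) → RespectsCut P →
                             Represents (conditionSide P s S)
                                        (restrict G inA a (filter (λ t → B.T? (P (proj₁ t))) F))
  conditionSide-represents S F rep s sat P resp x = begin
    output (conditionSide P s S) x       ≡⟨ Conditioning.output-condition (inside P) (fixCut s) S x ⟩
    output S y                           ≡⟨ rep y ⟩
    evalCNF y (toCNF G F)                ≡⟨ evalCNF-toCNF G y F ⟩
    all (evalClause y ∘ clauseOfTagged G) F
      ≡⟨ sym (all-filter-if (P ∘ proj₁) (evalCond x ∘ cond ∘ clauseOfTagged G) _
                            (evalCond s ∘ cond ∘ clauseOfTagged G) split F
                            (trans (sym (evalCNF-restrict s F)) sat)) ⟩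
    all (evalCond x ∘ cond ∘ clauseOfTagged G) (filter (λ t → B.T? (P (proj₁ t))) F)
      ≡⟨ sym (evalCNF-restrict x (filter (λ t → B.T? (P (proj₁ t))) F)) ⟩
    evalCNF x (restrict G inA a (filter (λ t → B.T? (P (proj₁ t))) F)) ∎
    where
    open ≡-Reasoning
    y : Assignment m
    y = override (inside P) x (fixCut s)
    split : (t : TaggedClause n m) → evalClause y (clauseOfTagged G t)
            ≡ (if P (proj₁ t) then evalCond x (cond (clauseOfTagged G t))
                              else evalCond s (cond (clauseOfTagged G t)))
    split (v , β) = trans (evalClause-override-inside resp x s v β)
                          (if-float (λ z → evalCond z (cond (clauseOf G v β))) (P v))

lemma7 : {n m : ℕ} (G : Graph n m) (c : Fin n → Bool)
    (F : List (TaggedClause n m)) → All (IsTseitinClause G c) F →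
    (T : VTree m) → IsVTree T →
    (S : StrDNNF m T) → Represents S (toCNF G F) →
    (inA : Fin n → Bool) (a : Assignment m) →
    Satisfiable (restrict G inA a F) →
    Σ[ SA ∈ StrDNNF m T ] Σ[ SB ∈ StrDNNF m T ]
    (size SA ≤ size S × size SB ≤ size S
    × Represents SA (restrictA G inA a F)
    × Represents SB (restrictB G inA a F))
lemma7 G c F _ T _ S rep inA a (s , sat) =
  conditionSide inA s S , conditionSide (not ∘ inA) s S ,
  ≤-reflexive (size-conditionSide inA s S) , ≤-reflexive (size-conditionSide (not ∘ inA) s S) ,
  conditionSide-represents S F rep s sat inA inA-respectsCut ,
  conditionSide-represents S F rep s sat (not ∘ inA) (not-respectsCut {inA} inA-respectsCut)
  where open Cut G inA a
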